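{- Let $\xi_{n,i}$ be defined by $\xi_{0,0}=1$, $\xi_{0,i}=0$ for $i\neq0$, and $\xi_{n+1,i}=(1+2n-6i)\xi_{n,i}+(n-2i+2)\xi_{n,i-1}-4(i+1)\xi_{n,i+1}$ for $n\geqslant 0$, and $\xi_n(x)=\sum_{i}\xi_{n,i}x^i$. Then $$\sum_{n=0}^\infty\xi_n(x)\frac{z^n}{n!}=\frac{\sqrt{1+x}}{\sqrt{1+x}\cos(z\sqrt{1+x})-\sin(z\sqrt{1+x})}.$$ In particular, for all $n\geqslant 0$, $\xi_{n,0}=s_n$, and for all $n\geqslant 1$, $\xi_{2n,n}=\xi_{2n-1,n-1}=E_{2n}$.
   Context: The Springer numbers $s_n$ are defined by $\sum_{n\geqslant0}s_n\frac{z^n}{n!}=\frac{1}{\cos z-\sin z}$. The secant numbers $E_{2n}$ are defined by $\sec z=\sum_{n\geqslant0}E_{2n}\frac{z^{2n}}{(2n)!}$ (equivalently, $E_{2n}$ is the number of alternating permutations $\pi(1)>\pi(2)<\pi(3)>\cdots$ of $[2n]$). -}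

module Defs where

open import Data.Nat as ℕ using (ℕ; zero; suc; ⌊_/2⌋)
open import Data.Nat.Combinatorics using (_C_)
open import Relation.Binary.PropositionalEquality using (_≡_)
open import Data.Integer using (ℤ; +_; -_; _+_; _-_; _*_; 0ℤ; 1ℤ)

Σ≤ : ℕ → (ℕ → ℤ) → ℤ
Σ≤ zero    f = f 0
Σ≤ (suc n) f = Σ≤ n f + f (suc n)

δ₀ : ℕ → ℤ
δ₀ zero    = 1ℤ
δ₀ (suc _) = 0ℤ

shift : (ℕ → ℤ) → ℕ → ℤ
shift p zero    = 0ℤ
shift p (suc i) = p i

-- The triangle ξ_{n,i} (i ≥ 0; ξ_{n,i} = 0 for i < 0 is built in via shift)

ξ : ℕ → ℕ → ℤ
ξ zero    zero    = 1ℤ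
ξ zero    (suc i) = 0ℤ
ξ (suc n) i =
    ((+ 1 + + (2 ℕ.* n)) - + (6 ℕ.* i)) * ξ n i
  + ((+ n - + (2 ℕ.* i)) + + 2) * shift (ξ n) i
  - + (4 ℕ.* (i ℕ.+ 1)) * ξ n (suc i)

-- Polynomials in x with integer coefficients, as coefficient functions
-- ℕ → ℤ (i ↦ coefficient of x^i).

Poly : Set
Poly = ℕ → ℤ

polyMul : Poly → Poly → Poly
polyMul p q i = Σ≤ i (λ j → p j * q (i ℕ.∸ j))

onePlusXPow : ℕ → Poly
onePlusXPow k i = + (k C i)

polyScale : ℤ → Poly → Poly
polyScale c p i = c * p i

polySub : Poly → Poly → Poly
polySub p q i = p i - q i

ξpoly : ℕ → Poly
ξpoly n = ξ n

-- Exponential generating functions: a sequence a stands for Σ a_n z^n/n!.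
-- Product of EGFs: (a·b)_n = Σ_k C(n,k) a_k b_{n-k}.

egfMul : (ℕ → ℤ) → (ℕ → ℤ) → ℕ → ℤ
egfMul a b n = Σ≤ n (λ k → + (n C k) * a k * b (n ℕ.∸ k))

egfMulP : (ℕ → Poly) → (ℕ → Poly) → ℕ → Poly
egfMulP a b n i = Σ≤ n (λ k → + (n C k) * polyMul (a k) (b (n ℕ.∸ k)) i)

oneP : ℕ → Poly
oneP n i = δ₀ n * δ₀ i

cosC : ℕ → ℤ
cosC zero          = 1ℤ
cosC (suc zero)    = 0ℤ
cosC (suc (suc m)) = - cosC m

sinC : ℕ → ℤ
sinC zero          = 0ℤ
sinC (suc zero)    = 1ℤ
sinC (suc (suc m)) = - sinC m

-- EGF coefficients (in z) of cos(z√(1+x)) :  z^{2k}/(2k)! ↦ (-1)^k (1+x)^k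
cosSqrtP : ℕ → Poly
cosSqrtP m = polyScale (cosC m) (onePlusXPow ⌊ m /2⌋)

-- EGF coefficients of sin(z√(1+x)) / √(1+x) : z^{2k+1}/(2k+1)! ↦ (-1)^k (1+x)^k
sinSqrtOverSqrtP : ℕ → Poly
sinSqrtOverSqrtP m = polyScale (sinC m) (onePlusXPow ⌊ m /2⌋)

-- Denominator after dividing numerator and denominator by √(1+x):
--   cos(z√(1+x)) - sin(z√(1+x))/√(1+x)
denomP : ℕ → Poly
denomP m = polySub (cosSqrtP m) (sinSqrtOverSqrtP m)

-- Springer numbers: Σ s_n z^n/n! = 1/(cos z - sin z),
-- i.e. (Σ s_n z^n/n!)·(cos z - sin z) = 1 as formal power series.

IsSpringer : (ℕ → ℤ) → Set
IsSpringer s = ∀ n → egfMul s (λ m → cosC m - sinC m) n ≡ δ₀ n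

-- Secant numbers: E n stands for E_{2n}.  sec z = Σ E_{2n} z^{2n}/(2n)!,
-- i.e. (Σ E_{2n} z^{2n}/(2n)!)·cos z = 1 as formal power series.
-- evenSeq E is the full EGF coefficient sequence: 2n ↦ E n, odd ↦ 0.
evenSeq : (ℕ → ℤ) → ℕ → ℤ
evenSeq E zero          = E 0
evenSeq E (suc zero)    = 0ℤ
evenSeq E (suc (suc m)) = evenSeq (λ k → E (suc k)) m

IsSecant : (ℕ → ℤ) → Set
IsSecant E = ∀ n → egfMul (evenSeq E) cosC n ≡ δ₀ n

-- Let F = Σ ξ_n(x) z^n/n! and D = cos(z√(1+x)) − sin(z√(1+x))/√(1+x), so that D_n = d_n (1+x)^⌊n/2⌋
-- with d_n = ±1. The operator T = ∂_z + (2+x)(−z∂_z + 2(1+x)∂_x) is a derivation of the ring of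
-- exponential series with polynomial coefficients. The recurrence for ξ says T F = F, and
-- (1+x)∂_x(1+x)^h = h(1+x)^h gives T D = −D; hence T(F D) = 0. As T G = 0 determines G_{n+1} from
-- G_n, F D = 1. At x = 0 this is the Springer identity. Since ξ_n and D_n have degree at most n/2 in x,
-- taking the coefficient of x^m in the z^{2m}-term (and 0 for odd powers of z) is multiplicative; it
-- sends F to Σ ξ_{2m,m} z^{2m}/(2m)!, D to cos z and 1 to 1, so ξ_{2m,m} = E_{2m}. Finally the
-- recurrence collapses to ξ_{2m+2,m+1} = ξ_{2m+1,m} because ξ_{2m+1,j} = 0 for j > m.

module Submission where

open import Data.Nat as ℕ using (ℕ; zero; suc; _≤_; _<_; z≤n; s≤s; ⌊_/2⌋)
import Data.Nat.Properties as ℕ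
open import Data.Nat.Combinatorics using (_C_; nCk+nC[k+1]≡[n+1]C[k+1]; k>n⇒nCk≡0; nCn≡1; nC1≡n)
open import Data.Integer using (ℤ; +_; -_; _+_; _-_; _*_; 0ℤ; 1ℤ; -1ℤ)
import Data.Integer.Properties as ℤ
import Data.Nat.Tactic.RingSolver as ℕ-Ring
open import Data.Integer.Tactic.RingSolver using (solve-∀)
import Algebra.Properties.CommutativeSemigroup as CommutativeSemigroupProperties
open import Algebra.Properties.AbelianGroup ℤ.+-0-abelianGroup using (∙-cancelˡ)
open import Function using (_∘_)
open import Data.Product using (_×_; _,_)
open import Data.Sum using (inj₁; inj₂)
open import Data.Empty using (⊥-elim)
open import Relation.Binary.Definitions using (tri<; tri≈; tri>)
open import Relation.Binary.PropositionalEquality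
open import Relation.Nullary using (yes; no)

open import Defs

module ℕ+ = CommutativeSemigroupProperties ℕ.+-commutativeSemigroup
module ℤ+ = CommutativeSemigroupProperties ℤ.+-commutativeSemigroup

data Parity : ℕ → Set where
  even : ∀ m → Parity (m ℕ.+ m)
  odd  : ∀ m → Parity (suc (m ℕ.+ m))

parity : ∀ n → Parity n
parity zero = even 0
parity (suc n) with parity n
... | even m = odd m
... | odd m  = subst Parity (cong suc (ℕ.+-suc m m)) (even (suc m))

⌊m+m/2⌋≡m : ∀ m → ⌊ m ℕ.+ m /2⌋ ≡ m
⌊m+m/2⌋≡m m = sym (ℕ.n≡⌊n+n/2⌋ m)

⌊1+m+m/2⌋≡m : ∀ m → ⌊ suc (m ℕ.+ m) /2⌋ ≡ m
⌊1+m+m/2⌋≡m zero    = refl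
⌊1+m+m/2⌋≡m (suc m) = trans (cong (λ k → suc ⌊ k /2⌋) (ℕ.+-suc m m)) (cong suc (⌊1+m+m/2⌋≡m m))

m+m≢1+n+n : ∀ m n → m ℕ.+ m ≢ suc (n ℕ.+ n)
m+m≢1+n+n m n e = ℕ.<-irrefl (trans (sym (cong (λ k → k ℕ.+ k) m≡n)) e) (ℕ.n<1+n (n ℕ.+ n))
  where
  m≡n : m ≡ n
  m≡n = trans (sym (⌊m+m/2⌋≡m m)) (trans (cong ⌊_/2⌋ e) (⌊1+m+m/2⌋≡m n))

m+m<n+n⇒m<n : ∀ {m n} → m ℕ.+ m < n ℕ.+ n → m < n
m+m<n+n⇒m<n {m} {n} m+m<n+n with m ℕ.<? n
... | yes m<n = m<n
... | no  m≮n = ⊥-elim (ℕ.<⇒≱ m+m<n+n (ℕ.+-mono-≤ n≤m n≤m))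
  where n≤m = ℕ.≮⇒≥ m≮n

⌊n/2⌋<j : ∀ {n j} → Parity n → n < j ℕ.+ j → ⌊ n /2⌋ < j
⌊n/2⌋<j {j = j} (even m) n<j+j = subst (_< j) (sym (⌊m+m/2⌋≡m m)) (m+m<n+n⇒m<n n<j+j)
⌊n/2⌋<j {j = j} (odd m)  n<j+j =
  subst (_< j) (sym (⌊1+m+m/2⌋≡m m)) (m+m<n+n⇒m<n (ℕ.<-trans (ℕ.n<1+n _) n<j+j))

Σ≤-cong : ∀ n {f g : ℕ → ℤ} → (∀ k → k ≤ n → f k ≡ g k) → Σ≤ n f ≡ Σ≤ n g
Σ≤-cong zero    f≗g = f≗g 0 z≤n
Σ≤-cong (suc n) f≗g =
  cong₂ _+_ (Σ≤-cong n (λ k k≤n → f≗g k (ℕ.m≤n⇒m≤1+n k≤n))) (f≗g (suc n) ℕ.≤-refl)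

Σ≤-+ : ∀ n (f g : ℕ → ℤ) → Σ≤ n (λ k → f k + g k) ≡ Σ≤ n f + Σ≤ n g
Σ≤-+ zero    f g = refl
Σ≤-+ (suc n) f g = trans (cong (_+ (f (suc n) + g (suc n))) (Σ≤-+ n f g))
                         (ℤ+.interchange (Σ≤ n f) (Σ≤ n g) (f (suc n)) (g (suc n)))

Σ≤-* : ∀ n c (f : ℕ → ℤ) → Σ≤ n (λ k → c * f k) ≡ c * Σ≤ n f
Σ≤-* zero    c f = refl
Σ≤-* (suc n) c f = trans (cong (_+ c * f (suc n)) (Σ≤-* n c f)) (sym (ℤ.*-distribˡ-+ c _ _))

Σ≤-zero : ∀ n (f : ℕ → ℤ) → (∀ k → k ≤ n → f k ≡ 0ℤ) → Σ≤ n f ≡ 0ℤ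
Σ≤-zero zero    f f≗0 = f≗0 0 z≤n
Σ≤-zero (suc n) f f≗0 =
  cong₂ _+_ (Σ≤-zero n f (λ k k≤n → f≗0 k (ℕ.m≤n⇒m≤1+n k≤n))) (f≗0 (suc n) ℕ.≤-refl)

Σ≤-suc : ∀ n (f : ℕ → ℤ) → Σ≤ (suc n) f ≡ f 0 + Σ≤ n (λ k → f (suc k))
Σ≤-suc zero    f = refl
Σ≤-suc (suc n) f = trans (cong (_+ f (suc (suc n))) (Σ≤-suc n f)) (ℤ.+-assoc (f 0) _ _)

Σ≤-single : ∀ n (f : ℕ → ℤ) j → j ≤ n → (∀ k → k ≤ n → k ≢ j → f k ≡ 0ℤ) → Σ≤ n f ≡ f j
Σ≤-single zero    f zero _ _ = refl
Σ≤-single (suc n) f j j≤1+n others with j ℕ.≟ suc n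
... | yes refl = trans (cong (_+ f (suc n)) (Σ≤-zero n f below)) (ℤ.+-identityˡ _)
  where
  below : ∀ k → k ≤ n → f k ≡ 0ℤ
  below k k≤n = others k (ℕ.m≤n⇒m≤1+n k≤n) (λ { refl → ℕ.<-irrefl refl (s≤s k≤n) })
... | no j≢1+n =
  trans (cong₂ _+_ (Σ≤-single n f j (ℕ.≤-pred (ℕ.≤∧≢⇒< j≤1+n j≢1+n))
                                     (λ k k≤n → others k (ℕ.m≤n⇒m≤1+n k≤n)))
                   (others (suc n) ℕ.≤-refl (λ e → j≢1+n (sym e))))
        (ℤ.+-identityʳ _)

pascal : ∀ h k → + (suc h C suc k) ≡ + (h C k) + + (h C suc k)
pascal h k = cong +_ (sym (nCk+nC[k+1]≡[n+1]C[k+1] h k))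

-- (1+x)∂_x (1+x)^h = h(1+x)^h, coefficientwise.
binomial-euler : ∀ h i → + i * + (h C i) + + suc i * + (h C suc i) ≡ + h * + (h C i)
binomial-euler zero    zero    = refl
binomial-euler zero    (suc i) = cong₂ _+_ (ℤ.*-zeroʳ (+ suc i)) (ℤ.*-zeroʳ (+ suc (suc i)))
binomial-euler (suc h) zero    =
  trans (ℤ.+-identityˡ (+ 1 * + (suc h C 1)))
  (trans (ℤ.*-identityˡ _) (trans (cong +_ (nC1≡n (suc h))) (sym (ℤ.*-identityʳ (+ suc h)))))
binomial-euler (suc h) (suc i) = begin
  + suc i * + (suc h C suc i) + + suc (suc i) * + (suc h C suc (suc i))
    ≡⟨ cong₂ (λ a b → + suc i * a + + suc (suc i) * b) (pascal h i) (pascal h (suc i)) ⟩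
  + suc i * (+ (h C i) + + (h C suc i)) + + suc (suc i) * (+ (h C suc i) + + (h C suc (suc i)))
    ≡⟨ regroup (+ i) (+ (h C i)) (+ (h C suc i)) (+ (h C suc (suc i))) ⟩
  (+ i * + (h C i) + + suc i * + (h C suc i)) + (+ suc i * + (h C suc i) + + suc (suc i) * + (h C suc (suc i)))
    + (+ (h C i) + + (h C suc i))
    ≡⟨ cong₂ (λ x y → x + y + (+ (h C i) + + (h C suc i))) (binomial-euler h i) (binomial-euler h (suc i)) ⟩
  + h * + (h C i) + + h * + (h C suc i) + (+ (h C i) + + (h C suc i))
    ≡⟨ factor (+ h) (+ (h C i)) (+ (h C suc i)) ⟩
  + suc h * (+ (h C i) + + (h C suc i))
    ≡⟨ cong (+ suc h *_) (pascal h i) ⟨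
  + suc h * + (suc h C suc i) ∎
  where
  open ≡-Reasoning
  regroup : ∀ I a b c → (+ 1 + I) * (a + b) + (+ 2 + I) * (b + c)
                      ≡ (I * a + (+ 1 + I) * b) + ((+ 1 + I) * b + (+ 2 + I) * c) + (a + b)
  regroup = solve-∀
  factor : ∀ H a b → H * a + H * b + (a + b) ≡ (+ 1 + H) * (a + b)
  factor = solve-∀

binomialSum : ℕ → (ℕ → ℕ → ℤ) → ℤ
binomialSum n f = Σ≤ n (λ k → + (n C k) * f k (n ℕ.∸ k))

binomialSum-cong : ∀ n {f g : ℕ → ℕ → ℤ} → (∀ k r → f k r ≡ g k r) → binomialSum n f ≡ binomialSum n g
binomialSum-cong n f≗g = Σ≤-cong n (λ k _ → cong (+ (n C k) *_) (f≗g k (n ℕ.∸ k)))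

binomialSum-+ : ∀ n (f g : ℕ → ℕ → ℤ) →
                binomialSum n (λ k r → f k r + g k r) ≡ binomialSum n f + binomialSum n g
binomialSum-+ n f g =
  trans (Σ≤-cong n (λ k _ → ℤ.*-distribˡ-+ (+ (n C k)) _ _)) (Σ≤-+ n _ _)

binomialSum-* : ∀ n c (f : ℕ → ℕ → ℤ) → binomialSum n (λ k r → c * f k r) ≡ c * binomialSum n f
binomialSum-* n c f = trans (Σ≤-cong n (λ k _ → swap c (+ (n C k)) _)) (Σ≤-* n c _)
  where
  swap : ∀ c a b → a * (c * b) ≡ c * (a * b)
  swap = solve-∀

binomialSum-pascal : ∀ n (f : ℕ → ℕ → ℤ) →
  binomialSum (suc n) f ≡ binomialSum n (λ k r → f (suc k) r) + binomialSum n (λ k r → f k (suc r))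
binomialSum-pascal n f = begin
  binomialSum (suc n) f
    ≡⟨ Σ≤-suc n _ ⟩
  first + Σ≤ n (λ k → + (suc n C suc k) * f (suc k) (n ℕ.∸ k))
    ≡⟨ cong (_+_ first) (trans (Σ≤-cong n (λ k _ → split k)) (Σ≤-+ n _ _)) ⟩
  first + (∂ˡ + rest)   ≡⟨ rotate first ∂ˡ rest ⟩
  ∂ˡ + (first + rest)   ≡⟨ cong (_+_ ∂ˡ) shifted ⟩
  ∂ˡ + ∂ʳ               ∎
  where
  open ≡-Reasoning
  ∂ˡ    = binomialSum n (λ k r → f (suc k) r)
  ∂ʳ    = binomialSum n (λ k r → f k (suc r))
  first = + 1 * f 0 (suc n)
  rest  = Σ≤ n (λ k → + (n C suc k) * f (suc k) (n ℕ.∸ k))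
  split : ∀ k → + (suc n C suc k) * f (suc k) (n ℕ.∸ k)
              ≡ + (n C k) * f (suc k) (n ℕ.∸ k) + + (n C suc k) * f (suc k) (n ℕ.∸ k)
  split k = trans (cong (_* f (suc k) (n ℕ.∸ k)) (pascal n k))
                  (ℤ.*-distribʳ-+ (f (suc k) (n ℕ.∸ k)) (+ (n C k)) (+ (n C suc k)))
  rotate : ∀ a b c → a + (b + c) ≡ b + (a + c)
  rotate = solve-∀
  shifted : first + rest ≡ ∂ʳ
  shifted = begin
    first + rest
      ≡⟨ Σ≤-suc n _ ⟨
    Σ≤ (suc n) (λ k → + (n C k) * f k (suc n ℕ.∸ k))
      ≡⟨ cong₂ _+_ (Σ≤-cong n (λ k k≤n → cong (λ r → + (n C k) * f k r) (ℕ.+-∸-assoc 1 k≤n)))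
                   (cong (λ c → + c * f (suc n) (n ℕ.∸ n)) (k>n⇒nCk≡0 (ℕ.n<1+n n))) ⟩
    ∂ʳ + 0ℤ * f (suc n) (n ℕ.∸ n)
      ≡⟨ ℤ.+-identityʳ ∂ʳ ⟩
    ∂ʳ ∎

binomialSum-θ : ∀ n (f : ℕ → ℕ → ℤ) →
  + n * binomialSum n f ≡ binomialSum n (λ k r → + k * f k r) + binomialSum n (λ k r → + r * f k r)
binomialSum-θ n f = trans (sym (Σ≤-* n (+ n) _)) (trans (Σ≤-cong n term) (Σ≤-+ n _ _))
  where
  expand : ∀ a b c x → (a + b) * (c * x) ≡ c * (a * x) + c * (b * x)
  expand = solve-∀
  term : ∀ k → k ≤ n → + n * (+ (n C k) * f k (n ℕ.∸ k))
                     ≡ + (n C k) * (+ k * f k (n ℕ.∸ k)) + + (n C k) * (+ (n ℕ.∸ k) * f k (n ℕ.∸ k))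
  term k k≤n = trans (cong (λ m → + m * (+ (n C k) * f k (n ℕ.∸ k))) (sym (ℕ.m+[n∸m]≡n k≤n)))
                     (expand (+ k) (+ (n ℕ.∸ k)) (+ (n C k)) (f k (n ℕ.∸ k)))

-- Polynomials

polyMul-cong : ∀ i {p p′ q q′ : Poly} → (∀ j → p j ≡ p′ j) → (∀ j → q j ≡ q′ j) →
               polyMul p q i ≡ polyMul p′ q′ i
polyMul-cong i p≗p′ q≗q′ = Σ≤-cong i (λ j _ → cong₂ _*_ (p≗p′ j) (q≗q′ (i ℕ.∸ j)))

polyMul-distribʳ : ∀ i (p p′ q : Poly) →
                   polyMul (λ j → p j + p′ j) q i ≡ polyMul p q i + polyMul p′ q i
polyMul-distribʳ i p p′ q =
  trans (Σ≤-cong i (λ j _ → ℤ.*-distribʳ-+ (q (i ℕ.∸ j)) (p j) (p′ j))) (Σ≤-+ i _ _)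

polyMul-distribˡ : ∀ i (p q q′ : Poly) →
                   polyMul p (λ j → q j + q′ j) i ≡ polyMul p q i + polyMul p q′ i
polyMul-distribˡ i p q q′ =
  trans (Σ≤-cong i (λ j _ → ℤ.*-distribˡ-+ (p j) (q (i ℕ.∸ j)) (q′ (i ℕ.∸ j)))) (Σ≤-+ i _ _)

polyMul-scaleˡ : ∀ i c (p q : Poly) → polyMul (λ j → c * p j) q i ≡ c * polyMul p q i
polyMul-scaleˡ i c p q = trans (Σ≤-cong i (λ j _ → ℤ.*-assoc c (p j) (q (i ℕ.∸ j)))) (Σ≤-* i c _)

polyMul-scaleʳ : ∀ i c (p q : Poly) → polyMul p (λ j → c * q j) i ≡ c * polyMul p q i
polyMul-scaleʳ i c p q = trans (Σ≤-cong i (λ j _ → swap c (p j) (q (i ℕ.∸ j)))) (Σ≤-* i c _)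
  where
  swap : ∀ c a b → a * (c * b) ≡ c * (a * b)
  swap = solve-∀

polyMul-shiftˡ : ∀ i (p q : Poly) → polyMul (shift p) q i ≡ shift (polyMul p q) i
polyMul-shiftˡ zero    p q = refl
polyMul-shiftˡ (suc i) p q = trans (Σ≤-suc i _) (ℤ.+-identityˡ _)

polyMul-shiftʳ : ∀ i (p q : Poly) → polyMul p (shift q) i ≡ shift (polyMul p q) i
polyMul-shiftʳ zero    p q = ℤ.*-zeroʳ (p 0)
polyMul-shiftʳ (suc i) p q =
  trans (cong₂ _+_ (Σ≤-cong i (λ j j≤i → cong (λ r → p j * shift q r) (ℕ.+-∸-assoc 1 j≤i)))
                   (trans (cong (λ r → p (suc i) * shift q r) (ℕ.n∸n≡0 i)) (ℤ.*-zeroʳ (p (suc i)))))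
        (ℤ.+-identityʳ _)

θ : Poly → Poly
θ p j = + j * p j

∂ : Poly → Poly
∂ p j = + suc j * p (suc j)

θ≗shift∂ : ∀ (p : Poly) j → θ p j ≡ shift (∂ p) j
θ≗shift∂ p zero    = refl
θ≗shift∂ p (suc j) = refl

polyMul-θ : ∀ i (p q : Poly) → + i * polyMul p q i ≡ polyMul (θ p) q i + polyMul p (θ q) i
polyMul-θ i p q = trans (sym (Σ≤-* i (+ i) _)) (trans (Σ≤-cong i term) (Σ≤-+ i _ _))
  where
  expand : ∀ a b x y → (a + b) * (x * y) ≡ (a * x) * y + x * (b * y)
  expand = solve-∀
  term : ∀ j → j ≤ i → + i * (p j * q (i ℕ.∸ j)) ≡ θ p j * q (i ℕ.∸ j) + p j * θ q (i ℕ.∸ j)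
  term j j≤i = trans (cong (λ m → + m * (p j * q (i ℕ.∸ j))) (sym (ℕ.m+[n∸m]≡n j≤i)))
                     (expand (+ j) (+ (i ℕ.∸ j)) (p j) (q (i ℕ.∸ j)))

polyMul-∂ : ∀ i (p q : Poly) → + suc i * polyMul p q (suc i) ≡ polyMul (∂ p) q i + polyMul p (∂ q) i
polyMul-∂ i p q = begin
  + suc i * polyMul p q (suc i)
    ≡⟨ polyMul-θ (suc i) p q ⟩
  polyMul (θ p) q (suc i) + polyMul p (θ q) (suc i)
    ≡⟨ cong₂ _+_ (polyMul-cong (suc i) {q = q} (θ≗shift∂ p) (λ _ → refl))
                 (polyMul-cong (suc i) {p = p} (λ _ → refl) (θ≗shift∂ q)) ⟩
  polyMul (shift (∂ p)) q (suc i) + polyMul p (shift (∂ q)) (suc i)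
    ≡⟨ cong₂ _+_ (polyMul-shiftˡ (suc i) (∂ p) q) (polyMul-shiftʳ (suc i) p (∂ q)) ⟩
  polyMul (∂ p) q i + polyMul p (∂ q) i ∎
  where open ≡-Reasoning

polyMul-identityˡ : ∀ i (q : Poly) → polyMul δ₀ q i ≡ q i
polyMul-identityˡ zero    q = ℤ.*-identityˡ (q 0)
polyMul-identityˡ (suc i) q =
  trans (Σ≤-suc i _) (trans (cong (_+_ (1ℤ * q (suc i))) (Σ≤-zero i _ (λ _ _ → refl)))
                            (trans (ℤ.+-identityʳ _) (ℤ.*-identityˡ (q (suc i)))))

DegreeAtMost : ℕ → Poly → Set
DegreeAtMost d p = ∀ j → d < j → p j ≡ 0ℤ

polyMul-degree : ∀ {a b p q} → DegreeAtMost a p → DegreeAtMost b q → DegreeAtMost (a ℕ.+ b) (polyMul p q)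
polyMul-degree {a} {b} {p} {q} deg-p deg-q i a+b<i = Σ≤-zero i _ term
  where
  term : ∀ j → j ≤ i → p j * q (i ℕ.∸ j) ≡ 0ℤ
  term j _ with j ℕ.≤? a
  ... | yes j≤a = trans (cong (p j *_) (deg-q (i ℕ.∸ j) (ℕ.m+n≤o⇒m≤o∸n (suc b) b+j<i))) (ℤ.*-zeroʳ (p j))
    where
    b+j<i : suc b ℕ.+ j ≤ i
    b+j<i = ℕ.≤-trans (s≤s (subst (b ℕ.+ j ≤_) (ℕ.+-comm b a) (ℕ.+-monoʳ-≤ b j≤a))) a+b<i
  ... | no j≰a  = trans (cong (_* q (i ℕ.∸ j)) (deg-p j (ℕ.≰⇒> j≰a))) (ℤ.*-zeroˡ (q (i ℕ.∸ j)))

polyMul-top : ∀ {a b p q} → DegreeAtMost a p → DegreeAtMost b q → polyMul p q (a ℕ.+ b) ≡ p a * q b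
polyMul-top {a} {b} {p} {q} deg-p deg-q =
  trans (Σ≤-single (a ℕ.+ b) _ a (ℕ.m≤m+n a b) others) (cong (λ r → p a * q r) (ℕ.m+n∸m≡n a b))
  where
  others : ∀ j → j ≤ a ℕ.+ b → j ≢ a → p j * q ((a ℕ.+ b) ℕ.∸ j) ≡ 0ℤ
  others j _ j≢a with ℕ.<-cmp j a
  ... | tri< j<a _ _ = trans (cong (p j *_) (deg-q _ (ℕ.m+n≤o⇒m≤o∸n (suc b) b+j<a+b))) (ℤ.*-zeroʳ (p j))
    where
    b+j<a+b : suc b ℕ.+ j ≤ a ℕ.+ b
    b+j<a+b = subst (suc (b ℕ.+ j) ≤_) (ℕ.+-comm b a) (ℕ.+-monoʳ-< b j<a)
  ... | tri≈ _ j≡a _ = ⊥-elim (j≢a j≡a)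
  ... | tri> _ _ a<j = trans (cong (_* q ((a ℕ.+ b) ℕ.∸ j)) (deg-p j a<j)) (ℤ.*-zeroˡ (q ((a ℕ.+ b) ℕ.∸ j)))

-- Exponential series with polynomial coefficients, and derivations

Series : Set
Series = ℕ → Poly

infix  4 _≐_
infixl 6 _⊕_
infixr 7 _⊙_
infixl 7 _⋆_

_≐_ : Series → Series → Set
A ≐ B = ∀ n i → A n i ≡ B n i

_⊕_ : Series → Series → Series
(A ⊕ B) n i = A n i + B n i

_⊙_ : ℤ → Series → Series
(c ⊙ A) n i = c * A n i

_⋆_ : Series → Series → Series
_⋆_ = egfMulP

-- (A ⋆ B) n i is definitionally binomialSum n (⋆-term A B i).
⋆-term : Series → Series → ℕ → ℕ → ℕ → ℤ
⋆-term A B i k r = polyMul (A k) (B r) i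

mulX : Series → Series
mulX A n = shift (A n)

shift-zero : ∀ {f : ℕ → ℤ} → (∀ j → f j ≡ 0ℤ) → ∀ i → shift f i ≡ 0ℤ
shift-zero f≗0 zero    = refl
shift-zero f≗0 (suc i) = f≗0 i

∂z θz θx ∂x : Series → Series
∂z A n   = A (suc n)
θz A n i = + n * A n i
θx A n   = θ (A n)
∂x A n   = ∂ (A n)

⋆-cong : ∀ {A A′ B B′} → A ≐ A′ → B ≐ B′ → A ⋆ B ≐ A′ ⋆ B′
⋆-cong A≐A′ B≐B′ n i = binomialSum-cong n (λ k r → polyMul-cong i (A≐A′ k) (B≐B′ r))

⋆-distribʳ-⊕ : ∀ A A′ B → (A ⊕ A′) ⋆ B ≐ A ⋆ B ⊕ A′ ⋆ B
⋆-distribʳ-⊕ A A′ B n i =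
  trans (binomialSum-cong n (λ k r → polyMul-distribʳ i (A k) (A′ k) (B r)))
        (binomialSum-+ n (⋆-term A B i) (⋆-term A′ B i))

⋆-distribˡ-⊕ : ∀ A B B′ → A ⋆ (B ⊕ B′) ≐ A ⋆ B ⊕ A ⋆ B′
⋆-distribˡ-⊕ A B B′ n i =
  trans (binomialSum-cong n (λ k r → polyMul-distribˡ i (A k) (B r) (B′ r)))
        (binomialSum-+ n (⋆-term A B i) (⋆-term A B′ i))

⋆-scaleˡ : ∀ c A B → (c ⊙ A) ⋆ B ≐ c ⊙ (A ⋆ B)
⋆-scaleˡ c A B n i =
  trans (binomialSum-cong n (λ k r → polyMul-scaleˡ i c (A k) (B r))) (binomialSum-* n c (⋆-term A B i))

⋆-scaleʳ : ∀ c A B → A ⋆ (c ⊙ B) ≐ c ⊙ (A ⋆ B)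
⋆-scaleʳ c A B n i =
  trans (binomialSum-cong n (λ k r → polyMul-scaleʳ i c (A k) (B r))) (binomialSum-* n c (⋆-term A B i))

⋆-mulXˡ : ∀ A B → mulX A ⋆ B ≐ mulX (A ⋆ B)
⋆-mulXˡ A B n zero    = Σ≤-zero n _ (λ k _ → ℤ.*-zeroʳ (+ (n C k)))
⋆-mulXˡ A B n (suc i) = binomialSum-cong n (λ k r → polyMul-shiftˡ (suc i) (A k) (B r))

⋆-mulXʳ : ∀ A B → A ⋆ mulX B ≐ mulX (A ⋆ B)
⋆-mulXʳ A B n zero    =
  Σ≤-zero n _ (λ k _ → trans (cong (+ (n C k) *_) (polyMul-shiftʳ 0 (A k) (B (n ℕ.∸ k))))
                             (ℤ.*-zeroʳ (+ (n C k))))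
⋆-mulXʳ A B n (suc i) = binomialSum-cong n (λ k r → polyMul-shiftʳ (suc i) (A k) (B r))

infixl 6 _⊞_
infixr 7 _⊡_

_⊞_ : (Series → Series) → (Series → Series) → Series → Series
(L ⊞ L′) A = L A ⊕ L′ A

_⊡_ : ℤ → (Series → Series) → Series → Series
(c ⊡ L) A = c ⊙ L A

record IsDerivation (L : Series → Series) : Set where
  constructor isDerivation
  field leibniz : ∀ A B → L (A ⋆ B) ≐ L A ⋆ B ⊕ A ⋆ L B

open IsDerivation

∂z-isDerivation : IsDerivation ∂z
∂z-isDerivation = isDerivation λ A B n i → binomialSum-pascal n (⋆-term A B i)

θz-isDerivation : IsDerivation θz
θz-isDerivation = isDerivation λ A B n i → trans (binomialSum-θ n (⋆-term A B i))
  (cong₂ _+_ (binomialSum-cong n (λ k r → sym (polyMul-scaleˡ i (+ k) (A k) (B r))))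
             (binomialSum-cong n (λ k r → sym (polyMul-scaleʳ i (+ r) (A k) (B r)))))

θx-isDerivation : IsDerivation θx
θx-isDerivation = isDerivation λ A B n i → trans (sym (binomialSum-* n (+ i) (⋆-term A B i)))
  (trans (binomialSum-cong n (λ k r → polyMul-θ i (A k) (B r)))
         (binomialSum-+ n (⋆-term (θx A) B i) (⋆-term A (θx B) i)))

∂x-isDerivation : IsDerivation ∂x
∂x-isDerivation = isDerivation λ A B n i → trans (sym (binomialSum-* n (+ suc i) (⋆-term A B (suc i))))
  (trans (binomialSum-cong n (λ k r → polyMul-∂ i (A k) (B r)))
         (binomialSum-+ n (⋆-term (∂x A) B i) (⋆-term A (∂x B) i)))

⊞-isDerivation : ∀ {L L′} → IsDerivation L → IsDerivation L′ → IsDerivation (L ⊞ L′)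
⊞-isDerivation {L} {L′} dL dL′ = isDerivation λ A B n i → begin
  L (A ⋆ B) n i + L′ (A ⋆ B) n i
    ≡⟨ cong₂ _+_ (leibniz dL A B n i) (leibniz dL′ A B n i) ⟩
  ((L A ⋆ B) n i + (A ⋆ L B) n i) + ((L′ A ⋆ B) n i + (A ⋆ L′ B) n i)
    ≡⟨ ℤ+.interchange ((L A ⋆ B) n i) ((A ⋆ L B) n i) ((L′ A ⋆ B) n i) ((A ⋆ L′ B) n i) ⟩
  ((L A ⋆ B) n i + (L′ A ⋆ B) n i) + ((A ⋆ L B) n i + (A ⋆ L′ B) n i)
    ≡⟨ sym (cong₂ _+_ (⋆-distribʳ-⊕ (L A) (L′ A) B n i) (⋆-distribˡ-⊕ A (L B) (L′ B) n i)) ⟩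
  ((L A ⊕ L′ A) ⋆ B) n i + (A ⋆ (L B ⊕ L′ B)) n i ∎
  where open ≡-Reasoning

⊡-isDerivation : ∀ c {L} → IsDerivation L → IsDerivation (c ⊡ L)
⊡-isDerivation c {L} dL = isDerivation λ A B n i →
  trans (cong (c *_) (leibniz dL A B n i))
  (trans (ℤ.*-distribˡ-+ c _ _)
         (sym (cong₂ _+_ (⋆-scaleˡ c (L A) B n i) (⋆-scaleʳ c A (L B) n i))))

mulX∘-isDerivation : ∀ {L} → IsDerivation L → IsDerivation (mulX ∘ L)
mulX∘-isDerivation {L} dL = isDerivation λ where
  A B n zero    → sym (cong₂ _+_ (⋆-mulXˡ (L A) B n 0) (⋆-mulXʳ A (L B) n 0))
  A B n (suc i) → trans (leibniz dL A B n i)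
                        (sym (cong₂ _+_ (⋆-mulXˡ (L A) B n (suc i)) (⋆-mulXʳ A (L B) n (suc i))))

K T : Series → Series
K = -1ℤ ⊡ θz ⊞ + 2 ⊡ θx ⊞ + 2 ⊡ ∂x
T = ∂z ⊞ + 2 ⊡ K ⊞ mulX ∘ K

K-isDerivation : IsDerivation K
K-isDerivation = ⊞-isDerivation (⊞-isDerivation (⊡-isDerivation -1ℤ θz-isDerivation)
                                                (⊡-isDerivation (+ 2) θx-isDerivation))
                                (⊡-isDerivation (+ 2) ∂x-isDerivation)

T-isDerivation : IsDerivation T
T-isDerivation = ⊞-isDerivation (⊞-isDerivation ∂z-isDerivation (⊡-isDerivation (+ 2) K-isDerivation))
                                (mulX∘-isDerivation K-isDerivation)

K-cong : ∀ (A B : Series) n → (∀ j → A n j ≡ B n j) → ∀ i → K A n i ≡ K B n i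
K-cong A B n A≗B i =
  cong₂ (λ x y → -1ℤ * (+ n * x) + + 2 * (+ i * x) + + 2 * (+ suc i * y)) (A≗B i) (A≗B (suc i))

-- The product of the two series is 1

-- The defining recurrence with its ℕ-products cast to ℤ, so that the ring solver treats n and i as atoms.
ξ-suc : ∀ n i → ξ (suc n) i ≡ (+ 1 + + 2 * + n - + 6 * + i) * ξ n i
                            + (+ n - + 2 * + i + + 2) * shift (ξ n) i
                            - + 4 * (+ i + + 1) * ξ n (suc i)
ξ-suc n i = recurrence (ℤ.pos-* 2 n) (ℤ.pos-* 6 i) (ℤ.pos-* 2 i) (ℤ.pos-* 4 (i ℕ.+ 1))
  where
  recurrence : ∀ {a b c d} → a ≡ + 2 * + n → b ≡ + 6 * + i → c ≡ + 2 * + i → d ≡ + 4 * (+ i + + 1) →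
               (+ 1 + a - b) * ξ n i + (+ n - c + + 2) * shift (ξ n) i - d * ξ n (suc i)
                 ≡ (+ 1 + + 2 * + n - + 6 * + i) * ξ n i + (+ n - + 2 * + i + + 2) * shift (ξ n) i
                   - + 4 * (+ i + + 1) * ξ n (suc i)
  recurrence refl refl refl refl = refl

T-ξ : T ξ ≐ ξ
T-ξ n zero    = trans (cong (λ x → x + + 2 * K ξ n 0 + 0ℤ) (ξ-suc n 0)) (identity (+ n) (ξ n 0) (ξ n 1))
  where
  identity : ∀ N x₀ x₁ →
    (+ 1 + + 2 * N - + 6 * + 0) * x₀ + (N - + 2 * + 0 + + 2) * 0ℤ - + 4 * (+ 0 + + 1) * x₁
      + + 2 * (-1ℤ * (N * x₀) + + 2 * (+ 0 * x₀) + + 2 * (+ 1 * x₁)) + 0ℤ ≡ x₀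
  identity = solve-∀
T-ξ n (suc i) = trans (cong (λ x → x + + 2 * K ξ n (suc i) + K ξ n i) (ξ-suc n (suc i)))
                      (identity (+ n) (+ i) (ξ n i) (ξ n (suc i)) (ξ n (suc (suc i))))
  where
  identity : ∀ N I x₀ x₁ x₂ →
    (+ 1 + + 2 * N - + 6 * (+ 1 + I)) * x₁ + (N - + 2 * (+ 1 + I) + + 2) * x₀ - + 4 * ((+ 1 + I) + + 1) * x₂
      + + 2 * (-1ℤ * (N * x₁) + + 2 * ((+ 1 + I) * x₁) + + 2 * ((+ 1 + (+ 1 + I)) * x₂))
      + (-1ℤ * (N * x₀) + + 2 * (I * x₀) + + 2 * ((+ 1 + I) * x₁)) ≡ x₁
  identity = solve-∀

cosMinusSin : ℕ → ℤ
cosMinusSin n = cosC n - sinC n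

cosMinusSin-suc-suc : ∀ n → cosMinusSin (suc (suc n)) ≡ - cosMinusSin n
cosMinusSin-suc-suc n = negate (cosC n) (sinC n)
  where
  negate : ∀ a b → - a - - b ≡ - (a - b)
  negate = solve-∀

cosMinusSin-odd : ∀ m → cosMinusSin (suc (m ℕ.+ m)) ≡ - cosMinusSin (m ℕ.+ m)
cosMinusSin-odd zero    = refl
cosMinusSin-odd (suc m) rewrite ℕ.+-suc m m =
  trans (cosMinusSin-suc-suc (suc (m ℕ.+ m)))
  (trans (cong -_ (cosMinusSin-odd m)) (cong -_ (sym (cosMinusSin-suc-suc (m ℕ.+ m)))))

denomP-scaledPower : ∀ n j → denomP n j ≡ cosMinusSin n * + (⌊ n /2⌋ C j)
denomP-scaledPower n j = factor (cosC n) (sinC n) (+ (⌊ n /2⌋ C j))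
  where
  factor : ∀ a b c → a * c - b * c ≡ (a - b) * c
  factor = solve-∀

denomP-even : ∀ m j → denomP (m ℕ.+ m) j ≡ cosMinusSin (m ℕ.+ m) * + (m C j)
denomP-even m j =
  trans (denomP-scaledPower (m ℕ.+ m) j) (cong (λ h → cosMinusSin (m ℕ.+ m) * + (h C j)) (⌊m+m/2⌋≡m m))

denomP-odd : ∀ m j → denomP (suc (m ℕ.+ m)) j ≡ - cosMinusSin (m ℕ.+ m) * + (m C j)
denomP-odd m j = trans (denomP-scaledPower (suc (m ℕ.+ m)) j)
  (cong₂ (λ c h → c * + (h C j)) (cosMinusSin-odd m) (⌊1+m+m/2⌋≡m m))

denomP-even-suc : ∀ m j → denomP (suc (suc (m ℕ.+ m))) j ≡ - cosMinusSin (m ℕ.+ m) * + (suc m C j)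
denomP-even-suc m j = trans (denomP-scaledPower (suc (suc (m ℕ.+ m))) j)
  (cong₂ (λ c h → c * + (suc h C j)) (cosMinusSin-suc-suc (m ℕ.+ m)) (⌊m+m/2⌋≡m m))

K-scaledPower : ∀ (A : Series) n a h → (∀ j → A n j ≡ a * + (h C j)) →
                ∀ i → K A n i ≡ a * (+ h + + h - + n) * + (h C i)
K-scaledPower A n a h A≗ i = begin
  K A n i
    ≡⟨ cong₂ (λ x y → -1ℤ * (+ n * x) + + 2 * (+ i * x) + + 2 * (+ suc i * y)) (A≗ i) (A≗ (suc i)) ⟩
  -1ℤ * (+ n * (a * c₀)) + + 2 * (+ i * (a * c₀)) + + 2 * (+ suc i * (a * c₁))
    ≡⟨ regroup (+ n) (+ i) a c₀ c₁ ⟩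
  a * (-1ℤ * (+ n * c₀) + + 2 * (+ i * c₀ + + suc i * c₁))
    ≡⟨ cong (λ e → a * (-1ℤ * (+ n * c₀) + + 2 * e)) (binomial-euler h i) ⟩
  a * (-1ℤ * (+ n * c₀) + + 2 * (+ h * c₀))
    ≡⟨ finish (+ n) (+ h) a c₀ ⟩
  a * (+ h + + h - + n) * c₀ ∎
  where
  open ≡-Reasoning
  c₀ = + (h C i)
  c₁ = + (h C suc i)
  regroup : ∀ N I a c₀ c₁ → -1ℤ * (N * (a * c₀)) + + 2 * (I * (a * c₀)) + + 2 * ((+ 1 + I) * (a * c₁))
                          ≡ a * (-1ℤ * (N * c₀) + + 2 * (I * c₀ + (+ 1 + I) * c₁))
  regroup = solve-∀
  finish : ∀ N H a c → a * (-1ℤ * (N * c) + + 2 * (H * c)) ≡ a * (H + H - N) * c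
  finish = solve-∀

K-denomP-even : ∀ m j → K denomP (m ℕ.+ m) j ≡ 0ℤ
K-denomP-even m j = trans (K-scaledPower denomP (m ℕ.+ m) c m (denomP-even m) j) (vanish c (+ m) (+ (m C j)))
  where
  c = cosMinusSin (m ℕ.+ m)
  vanish : ∀ c M x → c * (M + M - (M + M)) * x ≡ 0ℤ
  vanish = solve-∀

K-denomP-odd : ∀ m j → K denomP (suc (m ℕ.+ m)) j ≡ cosMinusSin (m ℕ.+ m) * + (m C j)
K-denomP-odd m j = trans (K-scaledPower denomP (suc (m ℕ.+ m)) (- c) m (denomP-odd m) j) (simplify c (+ m) (+ (m C j)))
  where
  c = cosMinusSin (m ℕ.+ m)
  simplify : ∀ c M x → - c * (M + M - (+ 1 + (M + M))) * x ≡ c * x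
  simplify = solve-∀

T-denomP-even : ∀ m i → T denomP (m ℕ.+ m) i ≡ -1ℤ * denomP (m ℕ.+ m) i
T-denomP-even m i = begin
  denomP (suc (m ℕ.+ m)) i + + 2 * K denomP (m ℕ.+ m) i + shift (K denomP (m ℕ.+ m)) i
    ≡⟨ cong₂ (λ x y → denomP (suc (m ℕ.+ m)) i + + 2 * x + y)
             (K-denomP-even m i) (shift-zero (K-denomP-even m) i) ⟩
  denomP (suc (m ℕ.+ m)) i + + 2 * 0ℤ + 0ℤ
    ≡⟨ cong (λ x → x + + 2 * 0ℤ + 0ℤ) (denomP-odd m i) ⟩
  - c * + (m C i) + + 2 * 0ℤ + 0ℤ
    ≡⟨ simplify c (+ (m C i)) ⟩
  -1ℤ * (c * + (m C i))
    ≡⟨ cong (-1ℤ *_) (denomP-even m i) ⟨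
  -1ℤ * denomP (m ℕ.+ m) i ∎
  where
  open ≡-Reasoning
  c = cosMinusSin (m ℕ.+ m)
  simplify : ∀ c x → - c * x + + 2 * 0ℤ + 0ℤ ≡ -1ℤ * (c * x)
  simplify = solve-∀

T-denomP-odd : ∀ m i → T denomP (suc (m ℕ.+ m)) i ≡ -1ℤ * denomP (suc (m ℕ.+ m)) i
T-denomP-odd m zero = begin
  denomP (suc (suc (m ℕ.+ m))) 0 + + 2 * K denomP (suc (m ℕ.+ m)) 0 + 0ℤ
    ≡⟨ cong₂ (λ x y → x + + 2 * y + 0ℤ) (denomP-even-suc m 0) (K-denomP-odd m 0) ⟩
  - c * + 1 + + 2 * (c * + 1) + 0ℤ
    ≡⟨ simplify c ⟩
  -1ℤ * (- c * + 1)
    ≡⟨ cong (-1ℤ *_) (denomP-odd m 0) ⟨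
  -1ℤ * denomP (suc (m ℕ.+ m)) 0 ∎
  where
  open ≡-Reasoning
  c = cosMinusSin (m ℕ.+ m)
  simplify : ∀ c → - c * + 1 + + 2 * (c * + 1) + 0ℤ ≡ -1ℤ * (- c * + 1)
  simplify = solve-∀
T-denomP-odd m (suc j) = begin
  denomP (suc (suc (m ℕ.+ m))) (suc j) + + 2 * K denomP (suc (m ℕ.+ m)) (suc j) + K denomP (suc (m ℕ.+ m)) j
    ≡⟨ cong₂ _+_ (cong₂ (λ x y → x + + 2 * y) (denomP-even-suc m (suc j)) (K-denomP-odd m (suc j)))
                 (K-denomP-odd m j) ⟩
  - c * + (suc m C suc j) + + 2 * (c * + (m C suc j)) + c * + (m C j)
    ≡⟨ cong (λ x → - c * x + + 2 * (c * + (m C suc j)) + c * + (m C j)) (pascal m j) ⟩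
  - c * (+ (m C j) + + (m C suc j)) + + 2 * (c * + (m C suc j)) + c * + (m C j)
    ≡⟨ simplify c (+ (m C j)) (+ (m C suc j)) ⟩
  -1ℤ * (- c * + (m C suc j))
    ≡⟨ cong (-1ℤ *_) (denomP-odd m (suc j)) ⟨
  -1ℤ * denomP (suc (m ℕ.+ m)) (suc j) ∎
  where
  open ≡-Reasoning
  c = cosMinusSin (m ℕ.+ m)
  simplify : ∀ c a b → - c * (a + b) + + 2 * (c * b) + c * a ≡ -1ℤ * (- c * b)
  simplify = solve-∀

T-denomP : T denomP ≐ -1ℤ ⊙ denomP
T-denomP n i with parity n
... | even m = T-denomP-even m i
... | odd m  = T-denomP-odd m i

K-oneP : ∀ n i → K oneP n i ≡ 0ℤ
K-oneP zero    zero    = refl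
K-oneP zero    (suc i) = vanish (+ 0) (+ i)
  where
  vanish : ∀ N I → -1ℤ * (N * 0ℤ) + + 2 * ((+ 1 + I) * 0ℤ) + + 2 * ((+ 2 + I) * 0ℤ) ≡ 0ℤ
  vanish = solve-∀
K-oneP (suc n) i       = vanish (+ suc n) (+ i)
  where
  vanish : ∀ N I → -1ℤ * (N * 0ℤ) + + 2 * (I * 0ℤ) + + 2 * ((+ 1 + I) * 0ℤ) ≡ 0ℤ
  vanish = solve-∀

-- T G n = G (suc n) + (2+x) K G n, and K G n only depends on G n.
T-kernel : ∀ G → (∀ n i → T G n i ≡ 0ℤ) → (∀ i → G 0 i ≡ oneP 0 i) → G ≐ oneP
T-kernel G TG≡0 G₀ zero    i = G₀ i
T-kernel G TG≡0 G₀ (suc n) i = begin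
  G (suc n) i
    ≡⟨ cleanup (G (suc n) i) ⟨
  G (suc n) i + + 2 * 0ℤ + 0ℤ
    ≡⟨ cong₂ (λ x y → G (suc n) i + + 2 * x + y) (K-zero i) (shift-zero K-zero i) ⟨
  G (suc n) i + + 2 * K G n i + shift (K G n) i
    ≡⟨ TG≡0 n i ⟩
  0ℤ ∎
  where
  open ≡-Reasoning
  K-zero : ∀ j → K G n j ≡ 0ℤ
  K-zero j = trans (K-cong G oneP n (T-kernel G TG≡0 G₀ n) j) (K-oneP n j)
  cleanup : ∀ x → x + + 2 * 0ℤ + 0ℤ ≡ x
  cleanup = solve-∀

ξ⋆denomP≐oneP : ξ ⋆ denomP ≐ oneP
ξ⋆denomP≐oneP = T-kernel (ξ ⋆ denomP) annihilated initial
  where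
  annihilated : ∀ n i → T (ξ ⋆ denomP) n i ≡ 0ℤ
  annihilated n i = begin
    T (ξ ⋆ denomP) n i
      ≡⟨ leibniz T-isDerivation ξ denomP n i ⟩
    (T ξ ⋆ denomP) n i + (ξ ⋆ T denomP) n i
      ≡⟨ cong₂ _+_ (⋆-cong {B = denomP} T-ξ (λ _ _ → refl) n i) (⋆-cong {A = ξ} (λ _ _ → refl) T-denomP n i) ⟩
    (ξ ⋆ denomP) n i + (ξ ⋆ (-1ℤ ⊙ denomP)) n i
      ≡⟨ cong (_+_ ((ξ ⋆ denomP) n i)) (⋆-scaleʳ -1ℤ ξ denomP n i) ⟩
    (ξ ⋆ denomP) n i + -1ℤ * (ξ ⋆ denomP) n i
      ≡⟨ cancel ((ξ ⋆ denomP) n i) ⟩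
    0ℤ ∎
    where
    open ≡-Reasoning
    cancel : ∀ x → x + -1ℤ * x ≡ 0ℤ
    cancel = solve-∀
  ξ₀≗δ₀ : ∀ j → ξ 0 j ≡ δ₀ j
  ξ₀≗δ₀ zero    = refl
  ξ₀≗δ₀ (suc j) = refl
  denomP₀≗δ₀ : ∀ j → denomP 0 j ≡ δ₀ j
  denomP₀≗δ₀ zero    = refl
  denomP₀≗δ₀ (suc j) = refl
  initial : ∀ i → (ξ ⋆ denomP) 0 i ≡ oneP 0 i
  initial i = cong (+ 1 *_) (trans (polyMul-cong i ξ₀≗δ₀ denomP₀≗δ₀) (polyMul-identityˡ i δ₀))

-- Springer numbers

egfMul-inverse-unique : ∀ (a b c : ℕ → ℤ) → c 0 ≡ 1ℤ →
  (∀ n → egfMul a c n ≡ δ₀ n) → (∀ n → egfMul b c n ≡ δ₀ n) → ∀ n → a n ≡ b n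
egfMul-inverse-unique a b c c₀≡1 ac≡δ₀ bc≡δ₀ n = agree n n ℕ.≤-refl
  where
  open ≡-Reasoning
  last : ∀ (s : ℕ → ℤ) n → + (n C n) * s n * c (n ℕ.∸ n) ≡ s n
  last s n = trans (cong₂ (λ x y → + x * s n * c y) (nCn≡1 n) (ℕ.n∸n≡0 n))
                   (trans (cong (1ℤ * s n *_) c₀≡1) (trans (ℤ.*-identityʳ _) (ℤ.*-identityˡ (s n))))
  agree : ∀ n k → k ≤ n → a k ≡ b k
  agree zero zero z≤n = begin
    a 0             ≡⟨ last a 0 ⟨
    egfMul a c 0    ≡⟨ trans (ac≡δ₀ 0) (sym (bc≡δ₀ 0)) ⟩
    egfMul b c 0    ≡⟨ last b 0 ⟩
    b 0             ∎
  agree (suc n) k k≤1+n with ℕ.m≤n⇒m<n∨m≡n k≤1+n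
  ... | inj₁ k<1+n = agree n k (ℕ.≤-pred k<1+n)
  ... | inj₂ refl  = ∙-cancelˡ earlier (a (suc n)) (b (suc n)) (begin
    earlier + a (suc n)     ≡⟨ cong (_+_ earlier) (last a (suc n)) ⟨
    egfMul a c (suc n)      ≡⟨ trans (ac≡δ₀ (suc n)) (sym (bc≡δ₀ (suc n))) ⟩
    egfMul b c (suc n)      ≡⟨ cong₂ _+_ (Σ≤-cong n (λ j j≤n → cong (λ x → + (suc n C j) * x * c (suc n ℕ.∸ j))
                                                                 (sym (agree n j j≤n))))
                                         (last b (suc n)) ⟩
    earlier + b (suc n)     ∎)
    where
    earlier = Σ≤ n (λ j → + (suc n C j) * a j * c (suc n ℕ.∸ j))

springer-unique : ∀ {s s′} → IsSpringer s → IsSpringer s′ → ∀ n → s n ≡ s′ n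
springer-unique {s} {s′} = egfMul-inverse-unique s s′ cosMinusSin refl

egfMul-congʳ : ∀ (a : ℕ → ℤ) {b b′ : ℕ → ℤ} → (∀ n → b n ≡ b′ n) → ∀ n → egfMul a b n ≡ egfMul a b′ n
egfMul-congʳ a b≗b′ n = Σ≤-cong n (λ k _ → cong (+ (n C k) * a k *_) (b≗b′ (n ℕ.∸ k)))

⋆-constantCoeff : ∀ A B n → (A ⋆ B) n 0 ≡ egfMul (λ k → A k 0) (λ k → B k 0) n
⋆-constantCoeff A B n = Σ≤-cong n (λ k _ → sym (ℤ.*-assoc (+ (n C k)) (A k 0) (B (n ℕ.∸ k) 0)))

ξ[-,0]-isSpringer : IsSpringer (λ n → ξ n 0)
ξ[-,0]-isSpringer n = begin
  egfMul (λ k → ξ k 0) cosMinusSin n            ≡⟨ egfMul-congʳ (λ k → ξ k 0) denomP[n,0] n ⟨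
  egfMul (λ k → ξ k 0) (λ k → denomP k 0) n     ≡⟨ ⋆-constantCoeff ξ denomP n ⟨
  (ξ ⋆ denomP) n 0                              ≡⟨ ξ⋆denomP≐oneP n 0 ⟩
  δ₀ n * 1ℤ                                     ≡⟨ ℤ.*-identityʳ (δ₀ n) ⟩
  δ₀ n                                          ∎
  where
  open ≡-Reasoning
  denomP[n,0] : ∀ k → denomP k 0 ≡ cosMinusSin k
  denomP[n,0] k = trans (denomP-scaledPower k 0) (ℤ.*-identityʳ (cosMinusSin k))

-- Secant numbers

evenSeq-even : ∀ (F : ℕ → ℤ) m → evenSeq F (m ℕ.+ m) ≡ F m
evenSeq-even F zero    = refl
evenSeq-even F (suc m) rewrite ℕ.+-suc m m = evenSeq-even (λ k → F (suc k)) m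

evenSeq-odd : ∀ (F : ℕ → ℤ) m → evenSeq F (suc (m ℕ.+ m)) ≡ 0ℤ
evenSeq-odd F zero    = refl
evenSeq-odd F (suc m) rewrite ℕ.+-suc m m = evenSeq-odd (λ k → F (suc k)) m

evenSeq-cong : ∀ {F G : ℕ → ℤ} → (∀ m → F m ≡ G m) → ∀ n → evenSeq F n ≡ evenSeq G n
evenSeq-cong F≗G zero          = F≗G 0
evenSeq-cong F≗G (suc zero)    = refl
evenSeq-cong F≗G (suc (suc n)) = evenSeq-cong (λ m → F≗G (suc m)) n

egfMul-evenSeq-odd : ∀ (E F : ℕ → ℤ) m → egfMul (evenSeq E) (evenSeq F) (suc (m ℕ.+ m)) ≡ 0ℤ
egfMul-evenSeq-odd E F m = Σ≤-zero n _ (λ k k≤n → term k (n ℕ.∸ k) (ℕ.m+[n∸m]≡n k≤n))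
  where
  n = suc (m ℕ.+ m)
  term : ∀ k r → k ℕ.+ r ≡ n → + (n C k) * evenSeq E k * evenSeq F r ≡ 0ℤ
  term k r k+r≡n with parity k | parity r
  ... | odd l  | _      = trans (cong (λ x → + (n C k) * x * evenSeq F r) (evenSeq-odd E l))
                                (trans (cong (_* evenSeq F r) (ℤ.*-zeroʳ (+ (n C k)))) (ℤ.*-zeroˡ (evenSeq F r)))
  ... | even l | odd t  = trans (cong (+ (n C k) * evenSeq E k *_) (evenSeq-odd F t))
                                (ℤ.*-zeroʳ (+ (n C k) * evenSeq E k))
  ... | even l | even t = ⊥-elim (m+m≢1+n+n (l ℕ.+ t) m (trans (ℕ+.interchange l t l t) k+r≡n))

secant-unique : ∀ {E E′} → IsSecant E → IsSecant E′ → ∀ m → E m ≡ E′ m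
secant-unique {E} {E′} isSecant isSecant′ m = begin
  E m                  ≡⟨ evenSeq-even E m ⟨
  evenSeq E (m ℕ.+ m)  ≡⟨ egfMul-inverse-unique _ _ cosC refl isSecant isSecant′ (m ℕ.+ m) ⟩
  evenSeq E′ (m ℕ.+ m) ≡⟨ evenSeq-even E′ m ⟩
  E′ m                 ∎
  where open ≡-Reasoning

HalfDegree : Series → Set
HalfDegree A = ∀ n j → n < j ℕ.+ j → A n j ≡ 0ℤ

diagonal : Series → ℕ → ℤ
diagonal A = evenSeq (λ m → A (m ℕ.+ m) m)

halfDegree-even : ∀ {A} → HalfDegree A → ∀ l → DegreeAtMost l (A (l ℕ.+ l))
halfDegree-even hA l j l<j = hA (l ℕ.+ l) j (ℕ.+-mono-< l<j l<j)

halfDegree-odd : ∀ {A} → HalfDegree A → ∀ l → DegreeAtMost l (A (suc (l ℕ.+ l)))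
halfDegree-odd hA l j l<j =
  hA (suc (l ℕ.+ l)) j (subst (_≤ j ℕ.+ j) (cong suc (ℕ.+-suc l l)) (ℕ.+-mono-≤ l<j l<j))

polyMul-diagonal : ∀ {A B} → HalfDegree A → HalfDegree B → ∀ k r m → k ℕ.+ r ≡ m ℕ.+ m →
                   polyMul (A k) (B r) m ≡ diagonal A k * diagonal B r
polyMul-diagonal {A} {B} hA hB k r m k+r≡m+m with parity k | parity r
... | even l | even t = begin
  polyMul (A (l ℕ.+ l)) (B (t ℕ.+ t)) m
    ≡⟨ cong (polyMul (A (l ℕ.+ l)) (B (t ℕ.+ t))) l+t≡m ⟨
  polyMul (A (l ℕ.+ l)) (B (t ℕ.+ t)) (l ℕ.+ t)
    ≡⟨ polyMul-top (halfDegree-even hA l) (halfDegree-even hB t) ⟩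
  A (l ℕ.+ l) l * B (t ℕ.+ t) t
    ≡⟨ cong₂ _*_ (evenSeq-even (λ m → A (m ℕ.+ m) m) l) (evenSeq-even (λ m → B (m ℕ.+ m) m) t) ⟨
  diagonal A (l ℕ.+ l) * diagonal B (t ℕ.+ t) ∎
  where
  open ≡-Reasoning
  l+t≡m : l ℕ.+ t ≡ m
  l+t≡m = trans (sym (⌊m+m/2⌋≡m (l ℕ.+ t)))
                (trans (cong ⌊_/2⌋ (trans (ℕ+.interchange l t l t) k+r≡m+m)) (⌊m+m/2⌋≡m m))
... | even l | odd t  =
  trans (polyMul-degree (halfDegree-even hA l) (halfDegree-odd hB t) m
           (m+m<n+n⇒m<n (subst (_≤ m ℕ.+ m) (shape l t) (ℕ.≤-reflexive k+r≡m+m))))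
        (sym (trans (cong (diagonal A k *_) (evenSeq-odd _ t)) (ℤ.*-zeroʳ (diagonal A k))))
  where
  shape : ∀ l t → (l ℕ.+ l) ℕ.+ suc (t ℕ.+ t) ≡ suc ((l ℕ.+ t) ℕ.+ (l ℕ.+ t))
  shape = ℕ-Ring.solve-∀
... | odd l  | even t =
  trans (polyMul-degree (halfDegree-odd hA l) (halfDegree-even hB t) m
           (m+m<n+n⇒m<n (subst (_≤ m ℕ.+ m) (shape l t) (ℕ.≤-reflexive k+r≡m+m))))
        (sym (trans (cong (_* diagonal B r) (evenSeq-odd _ l)) (ℤ.*-zeroˡ (diagonal B r))))
  where
  shape : ∀ l t → suc (l ℕ.+ l) ℕ.+ (t ℕ.+ t) ≡ suc ((l ℕ.+ t) ℕ.+ (l ℕ.+ t))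
  shape = ℕ-Ring.solve-∀
... | odd l  | odd t  =
  trans (polyMul-degree (halfDegree-odd hA l) (halfDegree-odd hB t) m
           (m+m<n+n⇒m<n (ℕ.<⇒≤ (subst (_≤ m ℕ.+ m) (shape l t) (ℕ.≤-reflexive k+r≡m+m)))))
        (sym (trans (cong (_* diagonal B r) (evenSeq-odd _ l)) (ℤ.*-zeroˡ (diagonal B r))))
  where
  shape : ∀ l t → suc (l ℕ.+ l) ℕ.+ suc (t ℕ.+ t) ≡ suc (suc ((l ℕ.+ t) ℕ.+ (l ℕ.+ t)))
  shape = ℕ-Ring.solve-∀

diagonal-⋆ : ∀ {A B} → HalfDegree A → HalfDegree B →
             ∀ n → diagonal (A ⋆ B) n ≡ egfMul (diagonal A) (diagonal B) n
diagonal-⋆ {A} {B} hA hB n with parity n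
... | odd m  = trans (evenSeq-odd _ m) (sym (egfMul-evenSeq-odd _ _ m))
... | even m = trans (evenSeq-even _ m) (Σ≤-cong (m ℕ.+ m) term)
  where
  term : ∀ k → k ≤ m ℕ.+ m → + ((m ℕ.+ m) C k) * polyMul (A k) (B (m ℕ.+ m ℕ.∸ k)) m
                          ≡ + ((m ℕ.+ m) C k) * diagonal A k * diagonal B (m ℕ.+ m ℕ.∸ k)
  term k k≤m+m = trans (cong (+ ((m ℕ.+ m) C k) *_) (polyMul-diagonal hA hB k _ m (ℕ.m+[n∸m]≡n k≤m+m)))
                       (sym (ℤ.*-assoc (+ ((m ℕ.+ m) C k)) (diagonal A k) (diagonal B (m ℕ.+ m ℕ.∸ k))))

diagonal-cong : ∀ {A B} → A ≐ B → ∀ n → diagonal A n ≡ diagonal B n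
diagonal-cong A≐B = evenSeq-cong (λ m → A≐B (m ℕ.+ m) m)

diagonal-oneP : ∀ n → diagonal oneP n ≡ δ₀ n
diagonal-oneP n with parity n
... | odd m  = evenSeq-odd _ m
... | even m = trans (evenSeq-even _ m) (δ₀-diagonal m)
  where
  δ₀-diagonal : ∀ m → δ₀ (m ℕ.+ m) * δ₀ m ≡ δ₀ (m ℕ.+ m)
  δ₀-diagonal zero    = refl
  δ₀-diagonal (suc m) = refl

sinC-even : ∀ m → sinC (m ℕ.+ m) ≡ 0ℤ
sinC-even zero    = refl
sinC-even (suc m) rewrite ℕ.+-suc m m | sinC-even m = refl

cosC-odd : ∀ m → cosC (suc (m ℕ.+ m)) ≡ 0ℤ
cosC-odd zero    = refl
cosC-odd (suc m) rewrite ℕ.+-suc m m | cosC-odd m = refl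

diagonal-denomP : ∀ n → diagonal denomP n ≡ cosC n
diagonal-denomP n with parity n
... | odd m  = trans (evenSeq-odd _ m) (sym (cosC-odd m))
... | even m = begin
  diagonal denomP (m ℕ.+ m)                   ≡⟨ evenSeq-even _ m ⟩
  denomP (m ℕ.+ m) m                          ≡⟨ denomP-even m m ⟩
  cosMinusSin (m ℕ.+ m) * + (m C m)           ≡⟨ cong (λ c → cosMinusSin (m ℕ.+ m) * + c) (nCn≡1 m) ⟩
  cosMinusSin (m ℕ.+ m) * 1ℤ                  ≡⟨ ℤ.*-identityʳ _ ⟩
  cosC (m ℕ.+ m) - sinC (m ℕ.+ m)             ≡⟨ cong (λ s → cosC (m ℕ.+ m) - s) (sinC-even m) ⟩
  cosC (m ℕ.+ m) - 0ℤ                         ≡⟨ ℤ.+-identityʳ _ ⟩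
  cosC (m ℕ.+ m)                              ∎
  where open ≡-Reasoning

denomP-halfDegree : HalfDegree denomP
denomP-halfDegree n j n<j+j = trans (denomP-scaledPower n j)
  (trans (cong (λ c → cosMinusSin n * + c) (k>n⇒nCk≡0 {⌊ n /2⌋} {j} (⌊n/2⌋<j (parity n) n<j+j)))
         (ℤ.*-zeroʳ (cosMinusSin n)))

ξ-halfDegree : HalfDegree ξ
ξ-halfDegree zero    (suc j) _ = refl
ξ-halfDegree (suc n) (suc j) 1+n<j+j = begin
  ξ (suc n) (suc j)
    ≡⟨ ξ-suc n (suc j) ⟩
  a * ξ n (suc j) + b * ξ n j - c * ξ n (suc (suc j))
    ≡⟨ cong₂ (λ x y → a * x + b * ξ n j - c * y) (ξ-halfDegree n (suc j) n<2j+2)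
                                                 (ξ-halfDegree n (suc (suc j)) n<2j+4) ⟩
  a * 0ℤ + b * ξ n j - c * 0ℤ
    ≡⟨ cong (λ x → a * 0ℤ + x - c * 0ℤ) middle ⟩
  a * 0ℤ + 0ℤ - c * 0ℤ
    ≡⟨ vanish a c ⟩
  0ℤ ∎
  where
  open ≡-Reasoning
  a = + 1 + + 2 * + n - + 6 * + suc j
  b = + n - + 2 * + suc j + + 2
  c = + 4 * (+ suc j + + 1)
  n<2j+2 : n < suc j ℕ.+ suc j
  n<2j+2 = ℕ.<-trans (ℕ.n<1+n n) 1+n<j+j
  n<2j+4 : n < suc (suc j) ℕ.+ suc (suc j)
  n<2j+4 = ℕ.<-≤-trans n<2j+2 (ℕ.+-mono-≤ (ℕ.n≤1+n (suc j)) (ℕ.n≤1+n (suc j)))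
  n≤j+j : n ≤ j ℕ.+ j
  n≤j+j = ℕ.≤-pred (subst (suc n ≤_) (ℕ.+-suc j j) (ℕ.≤-pred 1+n<j+j))
  middle : b * ξ n j ≡ 0ℤ
  middle with ℕ.m≤n⇒m<n∨m≡n n≤j+j
  ... | inj₁ n<j+j = trans (cong (b *_) (ξ-halfDegree n j n<j+j)) (ℤ.*-zeroʳ b)
  ... | inj₂ refl  = trans (cong (_* ξ n j) (coefficient (+ j))) (ℤ.*-zeroˡ (ξ n j))
    where
    coefficient : ∀ J → J + J - + 2 * (+ 1 + J) + + 2 ≡ 0ℤ
    coefficient = solve-∀
  vanish : ∀ a c → a * 0ℤ + 0ℤ - c * 0ℤ ≡ 0ℤ
  vanish = solve-∀

ξ[2m+2,m+1]≡ξ[2m+1,m] : ∀ m → ξ (suc (suc (m ℕ.+ m))) (suc m) ≡ ξ (suc (m ℕ.+ m)) m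
ξ[2m+2,m+1]≡ξ[2m+1,m] m = begin
  ξ (suc n) (suc m)
    ≡⟨ ξ-suc n (suc m) ⟩
  a * ξ n (suc m) + b * ξ n m - c * ξ n (suc (suc m))
    ≡⟨ cong₂ (λ x y → a * x + b * ξ n m - c * y) (ξ-halfDegree n (suc m) n<2m+2)
                                                 (ξ-halfDegree n (suc (suc m)) n<2m+4) ⟩
  a * 0ℤ + b * ξ n m - c * 0ℤ
    ≡⟨ simplify (+ m) a c (ξ n m) ⟩
  ξ n m ∎
  where
  open ≡-Reasoning
  n = suc (m ℕ.+ m)
  a = + 1 + + 2 * + n - + 6 * + suc m
  b = + n - + 2 * + suc m + + 2
  c = + 4 * (+ suc m + + 1)
  n<2m+2 : n < suc m ℕ.+ suc m
  n<2m+2 = subst (n <_) (sym (cong suc (ℕ.+-suc m m))) (ℕ.n<1+n n)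
  n<2m+4 : n < suc (suc m) ℕ.+ suc (suc m)
  n<2m+4 = ℕ.<-≤-trans n<2m+2 (ℕ.+-mono-≤ (ℕ.n≤1+n (suc m)) (ℕ.n≤1+n (suc m)))
  simplify : ∀ M a c x → a * 0ℤ + ((+ 1 + (M + M)) - + 2 * (+ 1 + M) + + 2) * x - c * 0ℤ ≡ x
  simplify = solve-∀

ξ-diagonal-isSecant : IsSecant (λ m → ξ (m ℕ.+ m) m)
ξ-diagonal-isSecant n = begin
  egfMul (diagonal ξ) cosC n                   ≡⟨ egfMul-congʳ (diagonal ξ) diagonal-denomP n ⟨
  egfMul (diagonal ξ) (diagonal denomP) n      ≡⟨ diagonal-⋆ ξ-halfDegree denomP-halfDegree n ⟨
  diagonal (ξ ⋆ denomP) n                      ≡⟨ diagonal-cong ξ⋆denomP≐oneP n ⟩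
  diagonal oneP n                              ≡⟨ diagonal-oneP n ⟩
  δ₀ n                                         ∎
  where open ≡-Reasoning

mainTheorem10 : (∀ n i → egfMulP ξpoly denomP n i ≡ oneP n i)
    × (∀ (s : ℕ → ℤ) → IsSpringer s → ∀ n → ξ n 0 ≡ s n)
    × (∀ (E : ℕ → ℤ) → IsSecant E → ∀ m →
    (ξ (2 ℕ.* suc m) (suc m) ≡ E (suc m)) × (ξ (suc (2 ℕ.* m)) m ≡ E (suc m)))
mainTheorem10 =
    ξ⋆denomP≐oneP
  , (λ s → springer-unique ξ[-,0]-isSpringer)
  , λ E isSecant m → let diagonal≡E = secant-unique ξ-diagonal-isSecant isSecant (suc m) in
      trans (cong (λ k → ξ k (suc m)) (2*m≡m+m (suc m))) diagonal≡E ,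
      (begin
        ξ (suc (2 ℕ.* m)) m               ≡⟨ cong (λ k → ξ (suc k) m) (2*m≡m+m m) ⟩
        ξ (suc (m ℕ.+ m)) m               ≡⟨ ξ[2m+2,m+1]≡ξ[2m+1,m] m ⟨
        ξ (suc (suc (m ℕ.+ m))) (suc m)   ≡⟨ cong (λ k → ξ (suc k) (suc m)) (ℕ.+-suc m m) ⟨
        ξ (suc m ℕ.+ suc m) (suc m)       ≡⟨ diagonal≡E ⟩
        E (suc m)                         ∎)
  where
  open ≡-Reasoning
  2*m≡m+m : ∀ m → 2 ℕ.* m ≡ m ℕ.+ m
  2*m≡m+m m = cong (m ℕ.+_) (ℕ.+-identityʳ m)
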